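{- Let $t,k,n$ be positive integers such that $t\le k$ and $n\ge(t+1)(k-t+1)$. Let $\mathcal F=\{F\in\binom{[n]}{k}:[t]\subseteq F\}$ and $\mathcal G=\{G\in\binom{[n]}{k}: |G\cap[t+2]|\ge t+1\}$. Then $\mathrm{co}_2(\mathcal G)\le\mathrm{co}_2(\mathcal F)$, and equality holds only if $k=t+1$ and $n=2t+2$; in this case $\mathcal F\cong\mathcal G^c=\{[n]\setminus G: G\in\mathcal G\}$.
   Context: $[n]=\{1,\dots,n\}$, $\binom{[n]}{k}$ is the set of $k$-subsets of $[n]$. For a family $\mathcal F\subseteq\binom{[n]}{k}$ and $E\subseteq[n]$, $d(E)$ is the number of members of $\mathcal F$ containing $E$, and $\mathrm{co}_2(\mathcal F)=\sum_{E\in\binom{[n]}{k-1}}d(E)^2$. $\cong$ means equality up to a permutation of $[n]$. -}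

module Defs where

open import Data.Bool using (Bool; true; false)
open import Data.Nat using (ℕ; zero; suc; _+_; _∸_; _^_; _<ᵇ_; _≤?_)
open import Data.Nat.Properties using (_≟_)
open import Data.Fin using (Fin; toℕ)
open import Data.Fin.Subset using (Subset; inside; outside; ∣_∣; _∩_; ∁)
open import Data.Fin.Subset.Properties using (_⊆?_)
open import Data.Fin.Permutation using (Permutation′; _⟨$⟩ˡ_)
open import Data.List using (List; []; _∷_; map; _++_; filter; length)
open import Data.Nat.ListAction using (sum)
open import Data.List.Membership.Propositional using (_∈_)
open import Data.Vec using ([]; _∷_; tabulate; lookup)
open import Data.Product using (Σ)
open import Function.Bundles using (_⇔_)

-- Ground set [n] is modelled as Fin n (element i+1 of [n] ↔ index i : Fin n).
-- All subsets of [n], each exactly once.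
allSubsets : (n : ℕ) → List (Subset n)
allSubsets zero = [] ∷ []
allSubsets (suc n) = map (outside ∷_) (allSubsets n) ++ map (inside ∷_) (allSubsets n)

kSubsets : (n k : ℕ) → List (Subset n)
kSubsets n k = filter (λ s → ∣ s ∣ ≟ k) (allSubsets n)

-- A family of subsets is a duplicate-free list of its members.
Family : ℕ → Set
Family n = List (Subset n)

initSeg : (n m : ℕ) → Subset n
initSeg n m = tabulate (λ i → toℕ i <ᵇ m)

deg : {n : ℕ} → Family n → Subset n → ℕ
deg 𝓕 E = length (filter (λ F → E ⊆? F) 𝓕)

co₂ : (n k : ℕ) → Family n → ℕ
co₂ n k 𝓕 = sum (map (λ E → deg 𝓕 E ^ 2) (kSubsets n (k ∸ 1)))

famF : (t n k : ℕ) → Family n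
famF t n k = filter (λ F → initSeg n t ⊆? F) (kSubsets n k)

famG : (t n k : ℕ) → Family n
famG t n k = filter (λ G → suc t ≤? ∣ G ∩ initSeg n (t + 2) ∣) (kSubsets n k)

compFam : {n : ℕ} → Family n → Family n
compFam 𝓖 = map ∁ 𝓖

permSub : {n : ℕ} → Permutation′ n → Subset n → Subset n
permSub σ S = tabulate (λ i → lookup S (σ ⟨$⟩ˡ i))

_≅_ : {n : ℕ} → Family n → Family n → Set
_≅_ {n} 𝓐 𝓑 = Σ (Permutation′ n) (λ σ → (S : Subset n) → (S ∈ 𝓐) ⇔ (permSub σ S ∈ 𝓑))

-- Both families are determined by the size of their trace on an initial segment [a]
-- (a = t for 𝓕, a = t + 2 for 𝓖).  Hence the degree of a (k − 1)-set E depends only on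
-- i = |E ∩ [a]| and l = |E ∖ [a]|: adding a point outside [a] keeps the trace size i,
-- adding one of the a − i free points of [a] raises it to i + 1, so
--   d(E) = [P i]·(n − a − l) + [P (i + 1)]·(a − i).
-- Summing d(E)² layer by layer, only two layers contribute to co₂(𝓕) and three to co₂(𝓖),
-- each weighted by binomial coefficients.
-- Write k = t + j and n = (t + 1)(j + 1) + w.  For j = 0 the family 𝓖 is empty.  For j = 1,
-- co₂(𝓕) − co₂(𝓖) = w(3t + 4 + w), which vanishes only for n = 2t + 2; there exchanging [t]
-- with the last t points maps 𝓕 onto the complements of 𝓖.  For j ≥ 2 the absorption
-- identity m·C(p, m) = (p − m + 1)·C(p, m − 1) (m = j − 1, p = n − t − 2) reduces the
-- comparison to a polynomial inequality in t, m and w with a positive surplus.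

{-# OPTIONS --safe #-}
module Submission where

open import Defs
open import Data.Bool using (true; false; if_then_else_; not)
open import Data.Bool.Properties using (not-involutive)
open import Data.Empty using (⊥-elim)
open import Data.Fin using (Fin; _↑ˡ_; _↑ʳ_; splitAt)
open import Data.Fin.Permutation using (Permutation′; permutation)
open import Data.Fin.Properties using (splitAt-↑ˡ; splitAt-↑ʳ; splitAt⁻¹-↑ˡ; splitAt⁻¹-↑ʳ)
open import Data.Fin.Subset using (Subset; inside; outside; ∣_∣; _∩_; ∁; _⊆_)
open import Data.Fin.Subset.Properties using (_⊆?_; ∣p∣≤n; ∣p∩q∣≤∣p∣; ∣∁p∣≡n∸∣p∣)
open import Data.List as List using (List; []; _∷_; map; filter; length)
open import Data.List.Membership.Propositional using (_∈_)
open import Data.List.Membership.Propositional.Properties using (∈-filter⁺; ∈-filter⁻; ∈-map⁺; ∈-map⁻; ∈-++⁺ˡ; ∈-++⁺ʳ)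
open import Data.List.Properties using (filter-none)
import Data.List.Properties as Listₚ
import Data.List.Relation.Unary.All as All
open import Data.List.Relation.Unary.All.Properties using (all-filter)
open import Data.List.Relation.Unary.Any using (here)
open import Data.Nat
open import Data.Nat.Combinatorics using (_C_; nCn≡1; nC1≡n; nCk+nC[k+1]≡[n+1]C[k+1]; nCk≡nC[n∸k])
open import Data.Nat.ListAction using (sum)
open import Data.Nat.ListAction.Properties using (sum-++)
open import Data.Nat.Properties
open import Data.Nat.Tactic.RingSolver using (solve-∀)
open import Algebra.Properties.CommutativeSemigroup +-commutativeSemigroup using () renaming (interchange to +-interchange)
open import Data.Product using (_×_; _,_; proj₂)
open import Data.Product.Function.NonDependent.Propositional using (_×-⇔_)
open import Data.Sum using (_⊎_; inj₁; inj₂)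
open import Data.Vec using ([]; _∷_; _++_; lookup)
import Data.Vec as Vec
open import Data.Vec.Properties using (lookup-++ˡ; lookup-++ʳ; tabulate∘lookup; tabulate-cong)
import Data.Vec.Properties as Vecₚ
open import Function using (_∘_)
open import Function.Bundles using (_⇔_; mk⇔)
open import Function.Properties.Equivalence using (⇔-setoid)
open import Level using (0ℓ)
open import Relation.Binary.PropositionalEquality hiding ([_])
import Relation.Binary.Reasoning.Setoid as SetoidReasoning
open import Relation.Nullary using (Dec; does; yes; no; ¬_)
open import Relation.Nullary.Decidable using (dec-true; dec-false; does-⇔)
open import Relation.Unary using (Decidable)

∑ : {A : Set} → List A → (A → ℕ) → ℕ
∑ xs f = sum (map f xs)

∑-++ : {A : Set} (xs ys : List A) (f : A → ℕ) → ∑ (xs List.++ ys) f ≡ ∑ xs f + ∑ ys f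
∑-++ xs ys f = trans (cong sum (Listₚ.map-++ f xs ys)) (sum-++ (map f xs) (map f ys))

∑-map : {A B : Set} (g : A → B) (xs : List A) (f : B → ℕ) → ∑ (map g xs) f ≡ ∑ xs (f ∘ g)
∑-map g xs f = cong sum (sym (Listₚ.map-∘ xs))

∑-cong : {A : Set} (xs : List A) {f g : A → ℕ} → (∀ x → f x ≡ g x) → ∑ xs f ≡ ∑ xs g
∑-cong xs f≗g = cong sum (Listₚ.map-cong f≗g xs)

∑-zero : {A : Set} (xs : List A) → ∑ xs (λ _ → 0) ≡ 0
∑-zero [] = refl
∑-zero (x ∷ xs) = ∑-zero xs

∑-+ : {A : Set} (xs : List A) (f g : A → ℕ) → ∑ xs (λ x → f x + g x) ≡ ∑ xs f + ∑ xs g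
∑-+ [] f g = refl
∑-+ (x ∷ xs) f g = trans (cong (f x + g x +_) (∑-+ xs f g)) (+-interchange (f x) (g x) (∑ xs f) (∑ xs g))

∑-*ˡ : {A : Set} (xs : List A) (c : ℕ) (f : A → ℕ) → ∑ xs (λ x → c * f x) ≡ c * ∑ xs f
∑-*ˡ [] c f = sym (*-zeroʳ c)
∑-*ˡ (x ∷ xs) c f = trans (cong (c * f x +_) (∑-*ˡ xs c f)) (sym (*-distribˡ-+ c (f x) (∑ xs f)))

[_] : {P : Set} → Dec P → ℕ
[ P? ] = if does P? then 1 else 0

[]-yes : {P : Set} (P? : Dec P) → P → [ P? ] ≡ 1
[]-yes P? p = cong (λ b → if b then 1 else 0) (dec-true P? p)

[]-no : {P : Set} (P? : Dec P) → ¬ P → [ P? ] ≡ 0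
[]-no P? ¬p = cong (λ b → if b then 1 else 0) (dec-false P? ¬p)

[]-does : ∀ {A B : Set} (A? : Dec A) (B? : Dec B) → does A? ≡ does B? → [ A? ] ≡ [ B? ]
[]-does A? B? = cong (λ b → if b then 1 else 0)

[]*-cong : {P : Set} (P? : Dec P) {x y : ℕ} → (P → x ≡ y) → [ P? ] * x ≡ [ P? ] * y
[]*-cong (yes p) x≡y = cong (_+ 0) (x≡y p)
[]*-cong (no _)  x≡y = refl

[+≟+] : ∀ c x y → [ c + x ≟ c + y ] ≡ [ x ≟ y ]
[+≟+] c x y = []-does (c + x ≟ c + y) (x ≟ y) (does-⇔ (mk⇔ (+-cancelˡ-≡ c x y) (cong (c +_))) (c + x ≟ c + y) (x ≟ y))

length-filter : {A : Set} {P : A → Set} (P? : Decidable P) (xs : List A) →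
                length (filter P? xs) ≡ ∑ xs (λ x → [ P? x ])
length-filter P? [] = refl
length-filter P? (x ∷ xs) with does (P? x)
... | true  = cong suc (length-filter P? xs)
... | false = length-filter P? xs

∑-filter : {A : Set} {P : A → Set} (P? : Decidable P) (xs : List A) (f : A → ℕ) →
           ∑ (filter P? xs) f ≡ ∑ xs (λ x → [ P? x ] * f x)
∑-filter P? [] f = refl
∑-filter P? (x ∷ xs) f with does (P? x)
... | true  = cong₂ _+_ (sym (+-identityʳ (f x))) (∑-filter P? xs f)
... | false = ∑-filter P? xs f

∑-allSubsets-suc : (r : ℕ) (f : Subset (suc r) → ℕ) →
                   ∑ (allSubsets (suc r)) f ≡ ∑ (allSubsets r) (f ∘ (outside ∷_)) + ∑ (allSubsets r) (f ∘ (inside ∷_))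
∑-allSubsets-suc r f = trans (∑-++ (map (outside ∷_) S) _ f) (cong₂ _+_ (∑-map _ S f) (∑-map _ S f))
  where S = allSubsets r

∑-allSubsets-++ : (a r : ℕ) (f : Subset (a + r) → ℕ) →
                  ∑ (allSubsets (a + r)) f ≡ ∑ (allSubsets a) (λ u → ∑ (allSubsets r) (λ v → f (u ++ v)))
∑-allSubsets-++ zero    r f = sym (+-identityʳ _)
∑-allSubsets-++ (suc a) r f = begin
  ∑ (allSubsets (suc a + r)) f
    ≡⟨ ∑-allSubsets-suc (a + r) f ⟩
  ∑ (allSubsets (a + r)) (f ∘ (outside ∷_)) + ∑ (allSubsets (a + r)) (f ∘ (inside ∷_))
    ≡⟨ cong₂ _+_ (∑-allSubsets-++ a r _) (∑-allSubsets-++ a r _) ⟩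
  _ ≡⟨ ∑-allSubsets-suc a _ ⟨
  ∑ (allSubsets (suc a)) (λ u → ∑ (allSubsets r) (λ v → f (u ++ v))) ∎
  where open ≡-Reasoning

∣++∣ : ∀ {a r} (u : Subset a) (v : Subset r) → ∣ u ++ v ∣ ≡ ∣ u ∣ + ∣ v ∣
∣++∣ []            v = refl
∣++∣ (outside ∷ u) v = ∣++∣ u v
∣++∣ (inside ∷ u)  v = cong suc (∣++∣ u v)

[⊆?-++] : ∀ {a r} (e u : Subset a) (e′ v : Subset r) → [ (e ++ e′) ⊆? (u ++ v) ] ≡ [ e ⊆? u ] * [ e′ ⊆? v ]
[⊆?-++] []            []            e′ v = sym (+-identityʳ _)
[⊆?-++] (outside ∷ e) (_ ∷ u)       e′ v = [⊆?-++] e u e′ v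
[⊆?-++] (inside ∷ e)  (outside ∷ u) e′ v = refl
[⊆?-++] (inside ∷ e)  (inside ∷ u)  e′ v = [⊆?-++] e u e′ v

initSeg-0-⊆? : ∀ {r} (v : Subset r) → does (initSeg r 0 ⊆? v) ≡ true
initSeg-0-⊆? []      = refl
initSeg-0-⊆? (_ ∷ v) = initSeg-0-⊆? v

initSeg-⊆?-++ : ∀ {t r} (u : Subset t) (v : Subset r) → does (initSeg (t + r) t ⊆? (u ++ v)) ≡ does (∣ u ∣ ≟ t)
initSeg-⊆?-++         []            v = initSeg-0-⊆? v
initSeg-⊆?-++ {suc t} (outside ∷ u) v =
  sym (dec-false (∣ u ∣ ≟ suc t) (λ ∣u∣≡1+t → 1+n≰n (subst (_≤ t) ∣u∣≡1+t (∣p∣≤n u))))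
initSeg-⊆?-++         (inside ∷ u)  v = initSeg-⊆?-++ u v

∣∩initSeg-0∣ : ∀ {r} (v : Subset r) → ∣ v ∩ initSeg r 0 ∣ ≡ 0
∣∩initSeg-0∣ []            = refl
∣∩initSeg-0∣ (outside ∷ v) = ∣∩initSeg-0∣ v
∣∩initSeg-0∣ (inside ∷ v)  = ∣∩initSeg-0∣ v

∣++∩initSeg∣ : ∀ {a r} b (u : Subset a) (v : Subset r) →
               ∣ (u ++ v) ∩ initSeg (a + r) (a + b) ∣ ≡ ∣ u ∣ + ∣ v ∩ initSeg r b ∣
∣++∩initSeg∣ b []            v = refl
∣++∩initSeg∣ b (outside ∷ u) v = ∣++∩initSeg∣ b u v
∣++∩initSeg∣ b (inside ∷ u)  v = cong suc (∣++∩initSeg∣ b u v)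

∣++∩initSeg-left∣ : ∀ {a r} (u : Subset a) (v : Subset r) → ∣ (u ++ v) ∩ initSeg (a + r) a ∣ ≡ ∣ u ∣
∣++∩initSeg-left∣ {a} {r} u v = subst (λ c → ∣ (u ++ v) ∩ initSeg (a + r) c ∣ ≡ ∣ u ∣) (+-identityʳ a)
  (trans (∣++∩initSeg∣ 0 u v) (trans (cong (∣ u ∣ +_) (∣∩initSeg-0∣ v)) (+-identityʳ ∣ u ∣)))

[n+1]Cn≡n+1 : ∀ n → suc n C n ≡ suc n
[n+1]Cn≡n+1 n = trans (nCk≡nC[n∸k] (n≤1+n n)) (trans (cong (suc n C_) (m+n∸n≡m 1 n)) (nC1≡n (suc n)))

2*[n+2]Cn≡[n+2]*[n+1] : ∀ n → 2 * (suc (suc n) C n) ≡ suc (suc n) * suc n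
2*[n+2]Cn≡[n+2]*[n+1] zero    = refl
2*[n+2]Cn≡[n+2]*[n+1] (suc n) = begin
  2 * ((3 + n) C suc n)                     ≡⟨ cong (2 *_) (nCk+nC[k+1]≡[n+1]C[k+1] (2 + n) n) ⟨
  2 * ((2 + n) C n + (2 + n) C suc n)       ≡⟨ *-distribˡ-+ 2 ((2 + n) C n) ((2 + n) C suc n) ⟩
  2 * ((2 + n) C n) + 2 * ((2 + n) C suc n) ≡⟨ cong₂ _+_ (2*[n+2]Cn≡[n+2]*[n+1] n) (cong (2 *_) ([n+1]Cn≡n+1 (suc n))) ⟩
  (2 + n) * (1 + n) + 2 * (2 + n)           ≡⟨ lemma n ⟩
  (3 + n) * (2 + n)                         ∎
  where
  open ≡-Reasoning
  lemma : ∀ n → (2 + n) * (1 + n) + 2 * (2 + n) ≡ (3 + n) * (2 + n)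
  lemma = solve-∀

2*[t+2]Ct : ∀ t → 2 * ((t + 2) C t) ≡ (2 + t) * (1 + t)
2*[t+2]Ct t = trans (cong (λ a → 2 * (a C t)) (+-comm t 2)) (2*[n+2]Cn≡[n+2]*[n+1] t)

s*nCs+[s+1]*nC[s+1]≡n*nCs : ∀ n s → s * (n C s) + suc s * (n C suc s) ≡ n * (n C s)
s*nCs+[s+1]*nC[s+1]≡n*nCs zero    zero    = refl
s*nCs+[s+1]*nC[s+1]≡n*nCs zero    (suc s) = cong₂ _+_ (*-zeroʳ (suc s)) (*-zeroʳ (suc (suc s)))
s*nCs+[s+1]*nC[s+1]≡n*nCs (suc n) zero    = trans (+-identityʳ _) (trans (nC1≡n (suc n)) (sym (*-identityʳ (suc n))))
s*nCs+[s+1]*nC[s+1]≡n*nCs (suc n) (suc s) = begin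
  suc s * (suc n C suc s) + suc (suc s) * (suc n C suc (suc s))
    ≡⟨ cong₂ (λ x y → suc s * x + suc (suc s) * y) (pascal s) (pascal (suc s)) ⟨
  suc s * (a + b) + suc (suc s) * (b + c)
    ≡⟨ lemma s n a b c ⟩
  (s * a + suc s * b) + (suc s * b + suc (suc s) * c) + (a + b)
    ≡⟨ cong₂ (λ x y → x + y + (a + b)) (s*nCs+[s+1]*nC[s+1]≡n*nCs n s) (s*nCs+[s+1]*nC[s+1]≡n*nCs n (suc s)) ⟩
  n * a + n * b + (a + b)
    ≡⟨ lemma′ n a b ⟩
  suc n * (a + b)
    ≡⟨ cong (suc n *_) (pascal s) ⟩
  suc n * (suc n C suc s)
    ∎
  where
  open ≡-Reasoning
  a = n C s
  b = n C suc s
  c = n C suc (suc s)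
  pascal : ∀ s → n C s + n C suc s ≡ suc n C suc s
  pascal = nCk+nC[k+1]≡[n+1]C[k+1] n
  lemma : ∀ s n a b c → suc s * (a + b) + suc (suc s) * (b + c) ≡ (s * a + suc s * b) + (suc s * b + suc (suc s) * c) + (a + b)
  lemma = solve-∀
  lemma′ : ∀ n a b → n * a + n * b + (a + b) ≡ suc n * (a + b)
  lemma′ = solve-∀

0<nCk : ∀ {n k} → k ≤ n → 0 < n C k
0<nCk {k = zero}  _         = s≤s z≤n
0<nCk {suc n} {suc k} (s≤s k≤n) =
  subst (0 <_) (nCk+nC[k+1]≡[n+1]C[k+1] n k) (<-≤-trans (0<nCk k≤n) (m≤m+n _ _))

-- Sums over subsets by size

sizeSum : ℕ → (ℕ → ℕ) → ℕ
sizeSum r h = ∑ (allSubsets r) (λ v → h ∣ v ∣)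

sizeSum-suc : (r : ℕ) (h : ℕ → ℕ) → sizeSum (suc r) h ≡ sizeSum r h + sizeSum r (h ∘ suc)
sizeSum-suc r h = ∑-allSubsets-suc r (λ v → h ∣ v ∣)

sizeSum-cong : (r : ℕ) {f g : ℕ → ℕ} → (∀ x → x ≤ r → f x ≡ g x) → sizeSum r f ≡ sizeSum r g
sizeSum-cong r f≗g = ∑-cong (allSubsets r) (λ v → f≗g ∣ v ∣ (∣p∣≤n v))

sizeSum-zero : (r : ℕ) {h : ℕ → ℕ} → (∀ x → x ≤ r → h x ≡ 0) → sizeSum r h ≡ 0
sizeSum-zero r h≗0 = trans (sizeSum-cong r h≗0) (∑-zero (allSubsets r))

sizeSum-+ : (r : ℕ) (f g : ℕ → ℕ) → sizeSum r (λ x → f x + g x) ≡ sizeSum r f + sizeSum r g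
sizeSum-+ r f g = ∑-+ (allSubsets r) _ _

sizeSum-*ʳ : (r : ℕ) (f : ℕ → ℕ) (c : ℕ) → sizeSum r (λ x → f x * c) ≡ sizeSum r f * c
sizeSum-*ʳ r f c = begin
  sizeSum r (λ x → f x * c) ≡⟨ ∑-cong (allSubsets r) (λ v → *-comm (f ∣ v ∣) c) ⟩
  sizeSum r (λ x → c * f x) ≡⟨ ∑-*ˡ (allSubsets r) c _ ⟩
  c * sizeSum r f           ≡⟨ *-comm c _ ⟩
  sizeSum r f * c           ∎
  where open ≡-Reasoning

sizeSum-supersets : (m : ℕ) (e : Subset m) (g : ℕ → ℕ) →
                    ∑ (allSubsets m) (λ v → [ e ⊆? v ] * g ∣ v ∣) ≡ sizeSum (m ∸ ∣ e ∣) (λ x → g (∣ e ∣ + x))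
sizeSum-supersets zero    []            g = cong (_+ 0) (+-identityʳ (g 0))
sizeSum-supersets (suc m) (outside ∷ e) g = begin
  _ ≡⟨ ∑-allSubsets-suc m _ ⟩
  _ ≡⟨ cong₂ _+_ (sizeSum-supersets m e g) (sizeSum-supersets m e (g ∘ suc)) ⟩
  sizeSum (m ∸ ∣ e ∣) (λ x → g (∣ e ∣ + x)) + sizeSum (m ∸ ∣ e ∣) (λ x → g (suc (∣ e ∣ + x)))
    ≡⟨ cong (sizeSum (m ∸ ∣ e ∣) (λ x → g (∣ e ∣ + x)) +_)
            (sizeSum-cong (m ∸ ∣ e ∣) (λ x _ → cong g (sym (+-suc ∣ e ∣ x)))) ⟩
  _ ≡⟨ sizeSum-suc (m ∸ ∣ e ∣) (λ x → g (∣ e ∣ + x)) ⟨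
  sizeSum (suc (m ∸ ∣ e ∣)) (λ x → g (∣ e ∣ + x))
    ≡⟨ cong (λ s → sizeSum s (λ x → g (∣ e ∣ + x))) (+-∸-assoc 1 (∣p∣≤n e)) ⟨
  sizeSum (suc m ∸ ∣ e ∣) (λ x → g (∣ e ∣ + x)) ∎
  where open ≡-Reasoning
sizeSum-supersets (suc m) (inside ∷ e)  g =
  trans (∑-allSubsets-suc m _) (cong₂ _+_ (∑-zero (allSubsets m)) (sizeSum-supersets m e (g ∘ suc)))

sizeSum-single : (r s : ℕ) (h : ℕ → ℕ) → (∀ x → x ≤ r → x ≢ s → h x ≡ 0) → sizeSum r h ≡ (r C s) * h s
sizeSum-single zero    zero    h vanish = refl
sizeSum-single zero    (suc s) h vanish = cong (_+ 0) (vanish 0 z≤n (λ ()))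
sizeSum-single (suc r) zero    h vanish = begin
  sizeSum (suc r) h                 ≡⟨ sizeSum-suc r h ⟩
  sizeSum r h + sizeSum r (h ∘ suc) ≡⟨ cong₂ _+_ (sizeSum-single r 0 h (λ x x≤r → vanish x (m≤n⇒m≤1+n x≤r)))
                                                 (sizeSum-zero r (λ x x≤r → vanish (suc x) (s≤s x≤r) (λ ()))) ⟩
  (r C 0) * h 0 + 0                 ≡⟨ +-identityʳ _ ⟩
  (suc r C 0) * h 0                 ∎
  where open ≡-Reasoning
sizeSum-single (suc r) (suc s) h vanish = begin
  sizeSum (suc r) h
    ≡⟨ sizeSum-suc r h ⟩
  sizeSum r h + sizeSum r (h ∘ suc)
    ≡⟨ cong₂ _+_ (sizeSum-single r (suc s) h (λ x x≤r → vanish x (m≤n⇒m≤1+n x≤r)))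
                 (sizeSum-single r s (h ∘ suc) (λ x x≤r x≢s → vanish (suc x) (s≤s x≤r) (x≢s ∘ suc-injective))) ⟩
  (r C suc s) * h (suc s) + (r C s) * h (suc s)
    ≡⟨ *-distribʳ-+ (h (suc s)) (r C suc s) (r C s) ⟨
  (r C suc s + r C s) * h (suc s)
    ≡⟨ cong (_* h (suc s)) (trans (+-comm (r C suc s) (r C s)) (nCk+nC[k+1]≡[n+1]C[k+1] r s)) ⟩
  (suc r C suc s) * h (suc s)
    ∎
  where open ≡-Reasoning

sizeSum-pick : (r s : ℕ) (h : ℕ → ℕ) → sizeSum r (λ x → [ x ≟ s ] * h x) ≡ (r C s) * h s
sizeSum-pick r s h = trans (sizeSum-single r s _ (λ x _ x≢s → cong (_* h x) ([]-no (x ≟ s) x≢s)))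
                           (cong ((r C s) *_) (trans (cong (_* h s) ([]-yes (s ≟ s) refl)) (*-identityˡ (h s))))

sizeSum-two : (r s₁ s₂ : ℕ) (h : ℕ → ℕ) → s₁ ≢ s₂ → (∀ x → x ≤ r → x ≢ s₁ → x ≢ s₂ → h x ≡ 0) →
              sizeSum r h ≡ (r C s₁) * h s₁ + (r C s₂) * h s₂
sizeSum-two r s₁ s₂ h s₁≢s₂ vanish = begin
  sizeSum r h                                                     ≡⟨ sizeSum-cong r split ⟩
  sizeSum r (λ x → [ x ≟ s₁ ] * h x + [ x ≟ s₂ ] * h x)           ≡⟨ sizeSum-+ r (pick s₁) (pick s₂) ⟩
  sizeSum r (λ x → [ x ≟ s₁ ] * h x) + sizeSum r (λ x → [ x ≟ s₂ ] * h x)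
    ≡⟨ cong₂ _+_ (sizeSum-pick r s₁ h) (sizeSum-pick r s₂ h) ⟩
  (r C s₁) * h s₁ + (r C s₂) * h s₂                               ∎
  where
  open ≡-Reasoning
  pick : ℕ → ℕ → ℕ
  pick s x = [ x ≟ s ] * h x
  cases : ∀ {x} → x ≤ r → (d₁ : Dec (x ≡ s₁)) (d₂ : Dec (x ≡ s₂)) → h x ≡ [ d₁ ] * h x + [ d₂ ] * h x
  cases x≤r (yes refl) (yes refl) = ⊥-elim (s₁≢s₂ refl)
  cases x≤r (yes _)    (no _)     = sym (trans (+-identityʳ _) (+-identityʳ _))
  cases x≤r (no _)     (yes _)    = sym (+-identityʳ _)
  cases x≤r (no x≢s₁)  (no x≢s₂)  = vanish _ x≤r x≢s₁ x≢s₂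
  split : ∀ x → x ≤ r → h x ≡ [ x ≟ s₁ ] * h x + [ x ≟ s₂ ] * h x
  split x x≤r = cases x≤r (x ≟ s₁) (x ≟ s₂)

sizeSum-three : (r s₁ s₂ s₃ : ℕ) (h : ℕ → ℕ) → s₁ ≢ s₂ → s₁ ≢ s₃ → s₂ ≢ s₃ →
                (∀ x → x ≤ r → x ≢ s₁ → x ≢ s₂ → x ≢ s₃ → h x ≡ 0) →
                sizeSum r h ≡ (r C s₁) * h s₁ + ((r C s₂) * h s₂ + (r C s₃) * h s₃)
sizeSum-three r s₁ s₂ s₃ h s₁≢s₂ s₁≢s₃ s₂≢s₃ vanish = begin
  sizeSum r h
    ≡⟨ sizeSum-cong r split ⟩
  sizeSum r (λ x → [ x ≟ s₁ ] * h x + ([ x ≟ s₂ ] * h x + [ x ≟ s₃ ] * h x))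
    ≡⟨ sizeSum-+ r (pick s₁) (λ x → pick s₂ x + pick s₃ x) ⟩
  sizeSum r (λ x → [ x ≟ s₁ ] * h x) + sizeSum r (λ x → [ x ≟ s₂ ] * h x + [ x ≟ s₃ ] * h x)
    ≡⟨ cong (sizeSum r (pick s₁) +_) (sizeSum-+ r (pick s₂) (pick s₃)) ⟩
  _ ≡⟨ cong₂ _+_ (sizeSum-pick r s₁ h) (cong₂ _+_ (sizeSum-pick r s₂ h) (sizeSum-pick r s₃ h)) ⟩
  (r C s₁) * h s₁ + ((r C s₂) * h s₂ + (r C s₃) * h s₃)
    ∎
  where
  open ≡-Reasoning
  pick : ℕ → ℕ → ℕ
  pick s x = [ x ≟ s ] * h x
  cases : ∀ {x} → x ≤ r → (d₁ : Dec (x ≡ s₁)) (d₂ : Dec (x ≡ s₂)) (d₃ : Dec (x ≡ s₃)) →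
          h x ≡ [ d₁ ] * h x + ([ d₂ ] * h x + [ d₃ ] * h x)
  cases x≤r (yes refl) (yes refl) _          = ⊥-elim (s₁≢s₂ refl)
  cases x≤r (yes refl) _          (yes refl) = ⊥-elim (s₁≢s₃ refl)
  cases x≤r _          (yes refl) (yes refl) = ⊥-elim (s₂≢s₃ refl)
  cases x≤r (yes _)    (no _)     (no _)     = sym (trans (+-identityʳ _) (+-identityʳ _))
  cases x≤r (no _)     (yes _)    (no _)     = sym (trans (+-identityʳ _) (+-identityʳ _))
  cases x≤r (no _)     (no _)     (yes _)    = sym (+-identityʳ _)
  cases x≤r (no x≢s₁)  (no x≢s₂)  (no x≢s₃)  = vanish _ x≤r x≢s₁ x≢s₂ x≢s₃
  split : ∀ x → x ≤ r → h x ≡ [ x ≟ s₁ ] * h x + ([ x ≟ s₂ ] * h x + [ x ≟ s₃ ] * h x)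
  split x x≤r = cases x≤r (x ≟ s₁) (x ≟ s₂) (x ≟ s₃)

lineSum : (r i M : ℕ) → (ℕ → ℕ) → ℕ
lineSum r i M f = sizeSum r (λ l → [ i + l ≟ M ] * f l)

lineCount : (r i M : ℕ) → ℕ
lineCount r i M = lineSum r i M (λ _ → 1)

lineSum-cong : (r i M : ℕ) {f g : ℕ → ℕ} → (∀ l → f l ≡ g l) → lineSum r i M f ≡ lineSum r i M g
lineSum-cong r i M f≗g = sizeSum-cong r (λ l _ → cong ([ i + l ≟ M ] *_) (f≗g l))

lineSum-on : (r i M : ℕ) (f : ℕ → ℕ) {c : ℕ} → (∀ l → i + l ≡ M → f l ≡ c) →
             lineSum r i M f ≡ lineCount r i M * c
lineSum-on r i M f {c} f≡c = trans (sizeSum-cong r (λ l _ → on l)) (sizeSum-*ʳ r (λ l → [ i + l ≟ M ] * 1) c)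
  where
  on : ∀ l → [ i + l ≟ M ] * f l ≡ [ i + l ≟ M ] * 1 * c
  on l = trans ([]*-cong (i + l ≟ M) (f≡c l)) (cong (_* c) (sym (*-identityʳ [ i + l ≟ M ])))

lineSum-beyond : (r i M : ℕ) (f : ℕ → ℕ) → M < i → lineSum r i M f ≡ 0
lineSum-beyond r i M f M<i = sizeSum-zero r (λ l _ → cong (_* f l) ([]-no (i + l ≟ M) (off l)))
  where
  off : ∀ l → i + l ≢ M
  off l i+l≡M = <⇒≱ M<i (subst (i ≤_) i+l≡M (m≤m+n i l))

lineCount-exact : (r i d : ℕ) → lineCount r i (i + d) ≡ r C d
lineCount-exact r i d = begin
  lineCount r i (i + d)
    ≡⟨ sizeSum-single r d _ (λ x _ x≢d → cong (_* 1) ([]-no (i + x ≟ i + d) (x≢d ∘ +-cancelˡ-≡ i x d))) ⟩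
  (r C d) * ([ i + d ≟ i + d ] * 1)
    ≡⟨ cong (λ b → (r C d) * (b * 1)) ([]-yes (i + d ≟ i + d) refl) ⟩
  (r C d) * 1
    ≡⟨ *-identityʳ _ ⟩
  r C d
    ∎
  where open ≡-Reasoning

lineCount-suc : (r i M : ℕ) → lineCount (suc r) i M ≡ lineCount r i M + lineCount r (suc i) M
lineCount-suc r i M =
  trans (sizeSum-suc r (λ l → [ i + l ≟ M ] * 1))
        (cong (lineCount r i M +_) (sizeSum-cong r (λ l _ → cong (λ z → [ z ≟ M ] * 1) (+-suc i l))))

lineCount-+2 : (r i M : ℕ) → lineCount (2 + r) i M
               ≡ lineCount r i M + lineCount r (suc i) M + (lineCount r (suc i) M + lineCount r (2 + i) M)
lineCount-+2 r i M = trans (lineCount-suc (suc r) i M) (cong₂ _+_ (lineCount-suc r i M) (lineCount-suc r (suc i) M))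

sizeSum-lineCount-1 : (a s : ℕ) (g : ℕ → ℕ) → sizeSum a (λ y → g y * lineCount s y 1) ≡ g 0 * s + a * g 1
sizeSum-lineCount-1 a s g = begin
  sizeSum a (λ y → g y * lineCount s y 1)
    ≡⟨ sizeSum-two a 0 1 (λ y → g y * lineCount s y 1) (λ ()) (λ y _ y≢0 y≢1 →
         trans (cong (g y *_) (lineSum-beyond s y 1 (λ _ → 1) (1<y y≢0 y≢1))) (*-zeroʳ (g y))) ⟩
  (a C 0) * (g 0 * lineCount s 0 1) + (a C 1) * (g 1 * lineCount s 1 1)
    ≡⟨ cong₂ (λ c x → 1 * (g 0 * x) + c * (g 1 * lineCount s 1 1)) (nC1≡n a) (trans (lineCount-exact s 0 1) (nC1≡n s)) ⟩
  1 * (g 0 * s) + a * (g 1 * lineCount s 1 1)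
    ≡⟨ cong (λ x → 1 * (g 0 * s) + a * (g 1 * x)) (lineCount-exact s 1 0) ⟩
  1 * (g 0 * s) + a * (g 1 * 1)
    ≡⟨ tidy (g 0) s (g 1) a ⟩
  g 0 * s + a * g 1
    ∎
  where
  open ≡-Reasoning
  tidy : ∀ b s c a → 1 * (b * s) + a * (c * 1) ≡ b * s + a * c
  tidy = solve-∀
  1<y : ∀ {y} → y ≢ 0 → y ≢ 1 → 1 < y
  1<y {0}           y≢0 _   = ⊥-elim (y≢0 refl)
  1<y {1}           _   y≢1 = ⊥-elim (y≢1 refl)
  1<y {suc (suc y)} _   _   = s≤s (s≤s z≤n)

-- Families determined by the size of a trace

module TraceFamily (a r M : ℕ) {X : Subset (a + r) → Set} (X? : Decidable X) {P : ℕ → Set} (P? : Decidable P)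
                   (trace : ∀ (u : Subset a) (v : Subset r) → does (X? (u ++ v)) ≡ does (P? ∣ u ∣)) where

  𝓗 : Family (a + r)
  𝓗 = filter X? (kSubsets (a + r) (suc M))

  layerDegree : ℕ → ℕ → ℕ
  layerDegree i l = [ P? i ] * (r ∸ l) + [ P? (suc i) ] * (a ∸ i)

  deg-as-double-sum : (e : Subset a) (e′ : Subset r) →
                      deg 𝓗 (e ++ e′) ≡ ∑ (allSubsets a) (λ u → ∑ (allSubsets r) (λ v →
                        [ e ⊆? u ] * ([ P? ∣ u ∣ ] * ([ e′ ⊆? v ] * [ ∣ u ∣ + ∣ v ∣ ≟ suc M ]))))
  deg-as-double-sum e e′ = begin
    deg 𝓗 (e ++ e′)
      ≡⟨ length-filter ((e ++ e′) ⊆?_) 𝓗 ⟩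
    ∑ 𝓗 (λ F → [ (e ++ e′) ⊆? F ])
      ≡⟨ ∑-filter X? (kSubsets (a + r) (suc M)) _ ⟩
    ∑ (kSubsets (a + r) (suc M)) (λ F → [ X? F ] * [ (e ++ e′) ⊆? F ])
      ≡⟨ ∑-filter (λ F → ∣ F ∣ ≟ suc M) (allSubsets (a + r)) _ ⟩
    ∑ (allSubsets (a + r)) (λ F → [ ∣ F ∣ ≟ suc M ] * ([ X? F ] * [ (e ++ e′) ⊆? F ]))
      ≡⟨ ∑-allSubsets-++ a r _ ⟩
    ∑ (allSubsets a) (λ u → ∑ (allSubsets r) (λ v →
        [ ∣ u ++ v ∣ ≟ suc M ] * ([ X? (u ++ v) ] * [ (e ++ e′) ⊆? (u ++ v) ])))
      ≡⟨ ∑-cong (allSubsets a) (λ u → ∑-cong (allSubsets r) (factor u)) ⟩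
    ∑ (allSubsets a) (λ u → ∑ (allSubsets r) (λ v →
        [ e ⊆? u ] * ([ P? ∣ u ∣ ] * ([ e′ ⊆? v ] * [ ∣ u ∣ + ∣ v ∣ ≟ suc M ]))))
      ∎
    where
    open ≡-Reasoning
    rearrange : ∀ s p c c′ → s * (p * (c * c′)) ≡ c * (p * (c′ * s))
    rearrange = solve-∀
    factor : ∀ u v → [ ∣ u ++ v ∣ ≟ suc M ] * ([ X? (u ++ v) ] * [ (e ++ e′) ⊆? (u ++ v) ])
                   ≡ [ e ⊆? u ] * ([ P? ∣ u ∣ ] * ([ e′ ⊆? v ] * [ ∣ u ∣ + ∣ v ∣ ≟ suc M ]))
    factor u v = trans (cong₂ (λ s x → [ s ≟ suc M ] * x) (∣++∣ u v)
                              (cong₂ _*_ ([]-does (X? (u ++ v)) (P? ∣ u ∣) (trace u v)) ([⊆?-++] e u e′ v)))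
                       (rearrange [ ∣ u ∣ + ∣ v ∣ ≟ suc M ] [ P? ∣ u ∣ ] [ e ⊆? u ] [ e′ ⊆? v ])

  deg-++ : (e : Subset a) (e′ : Subset r) →
           deg 𝓗 (e ++ e′) ≡ sizeSum (a ∸ ∣ e ∣) (λ y → [ P? (∣ e ∣ + y) ] *
                                sizeSum (r ∸ ∣ e′ ∣) (λ x → [ (∣ e ∣ + y) + (∣ e′ ∣ + x) ≟ suc M ]))
  deg-++ e e′ = begin
    deg 𝓗 (e ++ e′)
      ≡⟨ deg-as-double-sum e e′ ⟩
    ∑ (allSubsets a) (λ u → ∑ (allSubsets r) (λ v →
        [ e ⊆? u ] * ([ P? ∣ u ∣ ] * ([ e′ ⊆? v ] * [ ∣ u ∣ + ∣ v ∣ ≟ suc M ]))))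
      ≡⟨ ∑-cong (allSubsets a) (λ u → trans (∑-*ˡ (allSubsets r) [ e ⊆? u ] _)
                                             (cong ([ e ⊆? u ] *_) (∑-*ˡ (allSubsets r) [ P? ∣ u ∣ ] _))) ⟩
    ∑ (allSubsets a) (λ u → [ e ⊆? u ] * ([ P? ∣ u ∣ ] *
        ∑ (allSubsets r) (λ v → [ e′ ⊆? v ] * [ ∣ u ∣ + ∣ v ∣ ≟ suc M ])))
      ≡⟨ ∑-cong (allSubsets a) (λ u → cong (λ s → [ e ⊆? u ] * ([ P? ∣ u ∣ ] * s))
                                           (sizeSum-supersets r e′ (λ z → [ ∣ u ∣ + z ≟ suc M ]))) ⟩
    ∑ (allSubsets a) (λ u → [ e ⊆? u ] * ([ P? ∣ u ∣ ] *
        sizeSum (r ∸ ∣ e′ ∣) (λ x → [ ∣ u ∣ + (∣ e′ ∣ + x) ≟ suc M ])))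
      ≡⟨ sizeSum-supersets a e (λ z → [ P? z ] * sizeSum (r ∸ ∣ e′ ∣) (λ x → [ z + (∣ e′ ∣ + x) ≟ suc M ])) ⟩
    sizeSum (a ∸ ∣ e ∣) (λ y → [ P? (∣ e ∣ + y) ] *
        sizeSum (r ∸ ∣ e′ ∣) (λ x → [ (∣ e ∣ + y) + (∣ e′ ∣ + x) ≟ suc M ]))
      ∎
    where open ≡-Reasoning

  degree-on-layer : ∀ i l → i + l ≡ M →
                    sizeSum (a ∸ i) (λ y → [ P? (i + y) ] * sizeSum (r ∸ l) (λ x → [ (i + y) + (l + x) ≟ suc M ]))
                    ≡ layerDegree i l
  degree-on-layer i l i+l≡M = begin
    sizeSum (a ∸ i) (λ y → [ P? (i + y) ] * sizeSum (r ∸ l) (λ x → [ (i + y) + (l + x) ≟ suc M ]))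
      ≡⟨ sizeSum-cong (a ∸ i) (λ y _ → cong ([ P? (i + y) ] *_) (sizeSum-cong (r ∸ l) (λ x _ → one-more y x))) ⟩
    sizeSum (a ∸ i) (λ y → [ P? (i + y) ] * lineCount (r ∸ l) y 1)
      ≡⟨ sizeSum-lineCount-1 (a ∸ i) (r ∸ l) (λ y → [ P? (i + y) ]) ⟩
    [ P? (i + 0) ] * (r ∸ l) + (a ∸ i) * [ P? (i + 1) ]
      ≡⟨ cong₂ (λ x y → [ P? x ] * (r ∸ l) + (a ∸ i) * [ P? y ]) (+-identityʳ i) (+-comm i 1) ⟩
    [ P? i ] * (r ∸ l) + (a ∸ i) * [ P? (suc i) ]
      ≡⟨ cong ([ P? i ] * (r ∸ l) +_) (*-comm (a ∸ i) [ P? (suc i) ]) ⟩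
    layerDegree i l
      ∎
    where
    open ≡-Reasoning
    shuffle : ∀ i y l x → (i + y) + (l + x) ≡ (i + l) + (y + x)
    shuffle = solve-∀
    one-more : ∀ y x → [ (i + y) + (l + x) ≟ suc M ] ≡ [ y + x ≟ 1 ] * 1
    one-more y x = begin
      [ (i + y) + (l + x) ≟ suc M ]
        ≡⟨ cong₂ (λ s s′ → [ s ≟ s′ ]) (shuffle i y l x) (sym (trans (+-comm (i + l) 1) (cong suc i+l≡M))) ⟩
      [ (i + l) + (y + x) ≟ (i + l) + 1 ]
        ≡⟨ [+≟+] (i + l) (y + x) 1 ⟩
      [ y + x ≟ 1 ]
        ≡⟨ *-identityʳ _ ⟨
      [ y + x ≟ 1 ] * 1
        ∎

  layerDegree-≡ : ∀ i l {b c d} → [ P? i ] ≡ b → [ P? (suc i) ] ≡ c → a ∸ i ≡ d → layerDegree i l ≡ b * (r ∸ l) + c * d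
  layerDegree-≡ i l {b} {c} b≡ c≡ d≡ =
    trans (cong₂ (λ x y → x * (r ∸ l) + y * (a ∸ i)) b≡ c≡) (cong (λ z → b * (r ∸ l) + c * z) d≡)

  co₂-trace : co₂ (a + r) (suc M) 𝓗 ≡ sizeSum a (λ i → lineSum r i M (λ l → layerDegree i l ^ 2))
  co₂-trace = begin
    co₂ (a + r) (suc M) 𝓗
      ≡⟨ ∑-filter (λ E → ∣ E ∣ ≟ M) (allSubsets (a + r)) (λ E → deg 𝓗 E ^ 2) ⟩
    ∑ (allSubsets (a + r)) (λ E → [ ∣ E ∣ ≟ M ] * deg 𝓗 E ^ 2)
      ≡⟨ ∑-allSubsets-++ a r _ ⟩
    ∑ (allSubsets a) (λ u → ∑ (allSubsets r) (λ v → [ ∣ u ++ v ∣ ≟ M ] * deg 𝓗 (u ++ v) ^ 2))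
      ≡⟨ ∑-cong (allSubsets a) (λ u → ∑-cong (allSubsets r) (on-layer u)) ⟩
    sizeSum a (λ i → lineSum r i M (λ l → layerDegree i l ^ 2))
      ∎
    where
    open ≡-Reasoning
    on-layer : ∀ u v → [ ∣ u ++ v ∣ ≟ M ] * deg 𝓗 (u ++ v) ^ 2 ≡ [ ∣ u ∣ + ∣ v ∣ ≟ M ] * layerDegree ∣ u ∣ ∣ v ∣ ^ 2
    on-layer u v = trans (cong (λ s → [ s ≟ M ] * deg 𝓗 (u ++ v) ^ 2) (∣++∣ u v))
      ([]*-cong (∣ u ∣ + ∣ v ∣ ≟ M) (λ eq → cong (_^ 2) (trans (deg-++ u v) (degree-on-layer ∣ u ∣ ∣ v ∣ eq))))

  layer-vanishes : ∀ i → ¬ P i → ¬ P (suc i) → lineSum r i M (λ l → layerDegree i l ^ 2) ≡ 0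
  layer-vanishes i ¬Pi ¬P[1+i] = sizeSum-zero r (λ l _ →
    trans (cong (λ x → [ i + l ≟ M ] * x ^ 2) (layerDegree-≡ i l ([]-no (P? i) ¬Pi) ([]-no (P? (suc i)) ¬P[1+i]) refl))
          (*-zeroʳ [ i + l ≟ M ]))

co₂-famF : ∀ T q M → co₂ (suc T + q) (suc M) (famF (suc T) (suc T + q) (suc M))
                     ≡ lineSum q (suc T) M (λ l → (q ∸ l) ^ 2) + suc T * lineCount q T M
co₂-famF T q M = begin
  co₂ (t + q) (suc M) (famF t (t + q) (suc M))  ≡⟨ co₂-trace ⟩
  sizeSum t layer                               ≡⟨ sizeSum-two t t T layer 1+n≢n vanish ⟩
  (t C t) * layer t + (t C T) * layer T         ≡⟨ cong₂ _+_ (trans (cong (_* layer t) (nCn≡1 t)) (trans (*-identityˡ _) layer-t))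
                                                             (cong₂ _*_ ([n+1]Cn≡n+1 T) layer-T) ⟩
  lineSum q t M (λ l → (q ∸ l) ^ 2) + t * lineCount q T M ∎
  where
  open ≡-Reasoning
  t = suc T
  open TraceFamily t q M (initSeg (t + q) t ⊆?_) (_≟ t) initSeg-⊆?-++
  layer : ℕ → ℕ
  layer i = lineSum q i M (λ l → layerDegree i l ^ 2)
  vanish : ∀ x → x ≤ t → x ≢ t → x ≢ T → layer x ≡ 0
  vanish x _ x≢t x≢T = layer-vanishes x x≢t (x≢T ∘ suc-injective)
  layer-t : layer t ≡ lineSum q t M (λ l → (q ∸ l) ^ 2)
  layer-t = lineSum-cong q t M (λ l → cong (_^ 2)
    (trans (layerDegree-≡ t l ([]-yes (t ≟ t) refl) ([]-no (suc t ≟ t) 1+n≢n) refl) (trans (+-identityʳ _) (*-identityˡ _))))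
  layer-T : layer T ≡ lineCount q T M
  layer-T = lineSum-cong q T M (λ l → cong (_^ 2)
    (layerDegree-≡ T l ([]-no (T ≟ t) (1+n≢n ∘ sym)) ([]-yes (t ≟ t) refl) (m+n∸n≡m 1 T)))

co₂-famG : ∀ t p M → co₂ ((t + 2) + p) (suc M) (famG t ((t + 2) + p) (suc M))
                     ≡ ((t + 2) C t) * lineSum p t M (λ _ → 4)
                       + ((2 + t) * lineSum p (suc t) M (λ l → (p ∸ l + 1) ^ 2) + lineSum p (2 + t) M (λ l → (p ∸ l) ^ 2))
co₂-famG t p M = begin
  co₂ ((t + 2) + p) (suc M) (famG t ((t + 2) + p) (suc M))
    ≡⟨ co₂-trace ⟩
  sizeSum (t + 2) layer
    ≡⟨ sizeSum-three (t + 2) t (suc t) (2 + t) layer (1+n≢n ∘ sym) (m+1+n≢n 1 ∘ sym) (1+n≢n ∘ sym) vanish ⟩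
  ((t + 2) C t) * layer t + (((t + 2) C suc t) * layer (suc t) + ((t + 2) C (2 + t)) * layer (2 + t))
    ≡⟨ cong₂ _+_ (cong (((t + 2) C t) *_) layer-t)
                 (cong₂ _+_ (cong₂ _*_ C[t+2,1+t] layer-1+t) (trans (cong₂ _*_ C[t+2,2+t] layer-2+t) (*-identityˡ _))) ⟩
  ((t + 2) C t) * lineSum p t M (λ _ → 4)
    + ((2 + t) * lineSum p (suc t) M (λ l → (p ∸ l + 1) ^ 2) + lineSum p (2 + t) M (λ l → (p ∸ l) ^ 2))
    ∎
  where
  open ≡-Reasoning
  open TraceFamily (t + 2) p M (λ G → suc t ≤? ∣ G ∩ initSeg ((t + 2) + p) (t + 2) ∣) (suc t ≤?_)
                   (λ u v → cong (λ s → does (suc t ≤? s)) (∣++∩initSeg-left∣ u v))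
  layer : ℕ → ℕ
  layer i = lineSum p i M (λ l → layerDegree i l ^ 2)
  vanish : ∀ x → x ≤ t + 2 → x ≢ t → x ≢ suc t → x ≢ 2 + t → layer x ≡ 0
  vanish x x≤t+2 x≢t x≢1+t x≢2+t = layer-vanishes x (<⇒≱ (m<n⇒m<1+n x<t)) (<⇒≱ (s≤s x<t))
    where
    x<t : x < t
    x<t = ≤∧≢⇒< (≤-pred (≤∧≢⇒< (≤-pred (≤∧≢⇒< (subst (x ≤_) (+-comm t 2) x≤t+2) x≢2+t)) x≢1+t)) x≢t
  layer-t : layer t ≡ lineSum p t M (λ _ → 4)
  layer-t = lineSum-cong p t M (λ l → cong (_^ 2)
    (layerDegree-≡ t l ([]-no (suc t ≤? t) 1+n≰n) ([]-yes (suc t ≤? suc t) ≤-refl) (m+n∸m≡n t 2)))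
  layer-1+t : layer (suc t) ≡ lineSum p (suc t) M (λ l → (p ∸ l + 1) ^ 2)
  layer-1+t = lineSum-cong p (suc t) M (λ l → cong (_^ 2) (trans
    (layerDegree-≡ (suc t) l ([]-yes (suc t ≤? suc t) ≤-refl) ([]-yes (suc t ≤? 2 + t) (n≤1+n (suc t)))
                   (trans (cong (_∸ suc t) (+-suc t 1)) (m+n∸m≡n (suc t) 1)))
    (cong (_+ 1) (*-identityˡ (p ∸ l)))))
  layer-2+t : layer (2 + t) ≡ lineSum p (2 + t) M (λ l → (p ∸ l) ^ 2)
  layer-2+t = lineSum-cong p (2 + t) M (λ l → cong (_^ 2) (trans
    (layerDegree-≡ (2 + t) l ([]-yes (suc t ≤? 2 + t) (n≤1+n (suc t))) ([]-yes (suc t ≤? 3 + t) (m≤n⇒m≤1+n (n≤1+n (suc t))))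
                   (trans (cong (_∸ (2 + t)) (+-comm t 2)) (n∸n≡0 (2 + t))))
    (trans (+-identityʳ _) (*-identityˡ (p ∸ l)))))
  C[t+2,1+t] : (t + 2) C suc t ≡ 2 + t
  C[t+2,1+t] = trans (cong (_C suc t) (+-comm t 2)) ([n+1]Cn≡n+1 (suc t))
  C[t+2,2+t] : (t + 2) C (2 + t) ≡ 1
  C[t+2,2+t] = trans (cong (_C (2 + t)) (+-comm t 2)) (nCn≡1 (2 + t))

famG-empty : ∀ t n → famG t n t ≡ []
famG-empty t n = filter-none (λ G → suc t ≤? ∣ G ∩ initSeg n (t + 2) ∣)
  (All.map (λ {G} ∣G∣≡t t<∣G∩I∣ → 1+n≰n (≤-trans t<∣G∩I∣ (≤-trans (∣p∩q∣≤∣p∣ G _) (≤-reflexive ∣G∣≡t))))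
           (all-filter (λ s → ∣ s ∣ ≟ t) (allSubsets n)))

∸-offset : ∀ m d l u → d + l ≡ m → (m + u) ∸ l ≡ d + u
∸-offset m d l u d+l≡m = begin
  (m + u) ∸ l       ≡⟨ cong (λ z → (z + u) ∸ l) d+l≡m ⟨
  (d + l + u) ∸ l   ≡⟨ cong (_∸ l) (shuffle d l u) ⟩
  (l + (d + u)) ∸ l ≡⟨ m+n∸m≡n l (d + u) ⟩
  d + u             ∎
  where
  open ≡-Reasoning
  shuffle : ∀ d l u → d + l + u ≡ l + (d + u)
  shuffle = solve-∀

-- The case k = t + m + 1, n = t + 2 + p with p = m + u.  On [n] ∖ [t + 2] = [p] the layer counts are
-- A = C(p, m), B = C(p, m − 1), Y = C(p, m − 2) and Z = C(p, m + 1), read as 0 at negative arguments.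
module Layers (T m u : ℕ) where
  t = suc T
  p = m + u
  M = T + suc m
  N = 2 + u
  A = lineCount p t M
  B = lineCount p (suc t) M
  Y = lineCount p (2 + t) M
  Z = lineCount p T M

  offset : ∀ d l → (d + t) + l ≡ M → d + l ≡ m
  offset d l eq = suc-injective (+-cancelˡ-≡ T _ _ (trans (sym (shuffle d T l)) eq))
    where
    shuffle : ∀ d T l → (d + suc T) + l ≡ T + suc (d + l)
    shuffle = solve-∀

  co₂𝓕 : co₂ (t + (2 + p)) (suc M) (famF t (t + (2 + p)) (suc M)) ≡ (A + B + (B + Y)) * N ^ 2 + t * (Z + A + (A + B))
  co₂𝓕 = begin
    co₂ (t + (2 + p)) (suc M) (famF t (t + (2 + p)) (suc M))
      ≡⟨ co₂-famF T (2 + p) M ⟩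
    lineSum (2 + p) t M (λ l → (2 + p ∸ l) ^ 2) + t * lineCount (2 + p) T M
      ≡⟨ cong₂ (λ x y → x + t * y) (lineSum-on (2 + p) t M _ on-line) (lineCount-+2 p T M) ⟩
    lineCount (2 + p) t M * N ^ 2 + t * (Z + A + (A + B))
      ≡⟨ cong (λ x → x * N ^ 2 + t * (Z + A + (A + B))) (lineCount-+2 p t M) ⟩
    (A + B + (B + Y)) * N ^ 2 + t * (Z + A + (A + B))
      ∎
    where
    open ≡-Reasoning
    on-line : ∀ l → t + l ≡ M → (2 + p ∸ l) ^ 2 ≡ N ^ 2
    on-line l eq = cong (_^ 2) (∸-offset (2 + m) 2 l u (cong (2 +_) (offset 0 l eq)))

  co₂𝓖 : co₂ (t + (2 + p)) (suc M) (famG t (t + (2 + p)) (suc M)) ≡ ((t + 2) C t) * (A * 4) + ((2 + t) * (B * N ^ 2) + Y * N ^ 2)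
  co₂𝓖 = begin
    co₂ (t + (2 + p)) (suc M) (famG t (t + (2 + p)) (suc M))
      ≡⟨ cong (λ n → co₂ n (suc M) (famG t n (suc M))) (+-assoc t 2 p) ⟨
    co₂ ((t + 2) + p) (suc M) (famG t ((t + 2) + p) (suc M))
      ≡⟨ co₂-famG t p M ⟩
    ((t + 2) C t) * lineSum p t M (λ _ → 4)
      + ((2 + t) * lineSum p (suc t) M (λ l → (p ∸ l + 1) ^ 2) + lineSum p (2 + t) M (λ l → (p ∸ l) ^ 2))
      ≡⟨ cong₂ (λ x y → ((t + 2) C t) * x + ((2 + t) * y + lineSum p (2 + t) M (λ l → (p ∸ l) ^ 2)))
               (lineSum-on p t M _ (λ _ _ → refl)) (lineSum-on p (suc t) M _ on-line₁) ⟩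
    ((t + 2) C t) * (A * 4) + ((2 + t) * (B * N ^ 2) + lineSum p (2 + t) M (λ l → (p ∸ l) ^ 2))
      ≡⟨ cong (λ y → ((t + 2) C t) * (A * 4) + ((2 + t) * (B * N ^ 2) + y)) (lineSum-on p (2 + t) M _ on-line₂) ⟩
    ((t + 2) C t) * (A * 4) + ((2 + t) * (B * N ^ 2) + Y * N ^ 2)
      ∎
    where
    open ≡-Reasoning
    on-line₁ : ∀ l → suc t + l ≡ M → (p ∸ l + 1) ^ 2 ≡ N ^ 2
    on-line₁ l eq = trans (cong (λ x → (x + 1) ^ 2) (∸-offset m 1 l u (offset 1 l eq))) (cong (_^ 2) (+-comm (1 + u) 1))
    on-line₂ : ∀ l → 2 + t + l ≡ M → (p ∸ l) ^ 2 ≡ N ^ 2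
    on-line₂ l eq = cong (_^ 2) (∸-offset m 2 l u (offset 2 l eq))

co₂-excess-k≡t+1 : ∀ t w K A B Y Z → A ≡ 1 → B ≡ 0 → Z ≡ t + w → 2 * K ≡ (2 + t) * (1 + t) →
                   (A + B + (B + Y)) * (2 + (t + w)) ^ 2 + t * (Z + A + (A + B))
                   ≡ K * (A * 4) + ((2 + t) * (B * (2 + (t + w)) ^ 2) + Y * (2 + (t + w)) ^ 2) + w * (3 * t + 4 + w)
co₂-excess-k≡t+1 t w K .1 .0 Y .(t + w) refl refl refl 2K≡ = begin
  (1 + 0 + (0 + Y)) * (2 + (t + w)) ^ 2 + t * ((t + w) + 1 + (1 + 0))
    ≡⟨ expand t w Y ⟩
  (2 + t) * (1 + t) * 2 + Y * (2 + (t + w)) ^ 2 + w * (3 * t + 4 + w)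
    ≡⟨ cong (λ z → z * 2 + Y * (2 + (t + w)) ^ 2 + w * (3 * t + 4 + w)) 2K≡ ⟨
  2 * K * 2 + Y * (2 + (t + w)) ^ 2 + w * (3 * t + 4 + w)
    ≡⟨ collect K Y (2 + (t + w)) t w ⟩
  K * (1 * 4) + ((2 + t) * (0 * (2 + (t + w)) ^ 2) + Y * (2 + (t + w)) ^ 2) + w * (3 * t + 4 + w)
    ∎
  where
  open ≡-Reasoning
  expand : ∀ t w Y → let N = 2 + (t + w) in
           (1 + 0 + (0 + Y)) * (N * (N * 1)) + t * ((t + w) + 1 + (1 + 0))
           ≡ (2 + t) * (1 + t) * 2 + Y * (N * (N * 1)) + w * (3 * t + 4 + w)
  expand = solve-∀
  collect : ∀ K Y N t w → 2 * K * 2 + Y * (N * (N * 1)) + w * (3 * t + 4 + w)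
                          ≡ K * (1 * 4) + ((2 + t) * (0 * (N * (N * 1))) + Y * (N * (N * 1))) + w * (3 * t + 4 + w)
  collect = solve-∀

co₂-gap : ∀ t m u S K A B Y Z → 2 * K ≡ (2 + t) * (1 + t) → m * A ≡ (1 + u) * B → 0 < B →
          m * t * S + 2 * (1 + t) * (2 + t) * (1 + u) < (1 + u) * (S + 2 * t) →
          K * (A * 4) + ((2 + t) * (B * S) + Y * S) < (A + B + (B + Y)) * S + t * (Z + A + (A + B))
-- Multiplied by m, both sides become linear in B once m * A is replaced by (1 + u) * B.
co₂-gap t m u S K A B Y Z 2K≡ mA≡ 0<B L<H = *-cancelˡ-< m _ _ (begin-strict
  m * (K * (A * 4) + ((2 + t) * (B * S) + Y * S))
    ≡⟨ expandG m K A t B S Y ⟩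
  2 * (2 * K) * (m * A) + (m * t * (B * S) + R)
    ≡⟨ cong₂ (λ c x → 2 * c * x + (m * t * (B * S) + R)) 2K≡ mA≡ ⟩
  2 * ((2 + t) * (1 + t)) * ((1 + u) * B) + (m * t * (B * S) + R)
    ≡⟨ collectG t u B m S Y ⟩
  B * (m * t * S + 2 * (1 + t) * (2 + t) * (1 + u)) + R
    <⟨ +-monoˡ-< R (*-monoʳ-< B {{>-nonZero 0<B}} L<H) ⟩
  B * ((1 + u) * (S + 2 * t)) + R
    ≤⟨ m≤m+n _ (m * t * (Z + B)) ⟩
  B * ((1 + u) * (S + 2 * t)) + R + m * t * (Z + B)
    ≡⟨ collectF t u B m S Y Z ⟨
  (1 + u) * B * S + 2 * t * ((1 + u) * B) + R + m * t * (Z + B)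
    ≡⟨ cong (λ x → x * S + 2 * t * x + R + m * t * (Z + B)) mA≡ ⟨
  m * A * S + 2 * t * (m * A) + R + m * t * (Z + B)
    ≡⟨ expandF m A B Y S t Z ⟨
  m * ((A + B + (B + Y)) * S + t * (Z + A + (A + B)))
    ∎)
  where
  open ≤-Reasoning
  R = 2 * m * (B * S) + m * (Y * S)
  expandG : ∀ m K A t B S Y → m * (K * (A * 4) + ((2 + t) * (B * S) + Y * S))
                              ≡ 2 * (2 * K) * (m * A) + (m * t * (B * S) + (2 * m * (B * S) + m * (Y * S)))
  expandG = solve-∀
  collectG : ∀ t u B m S Y → 2 * ((2 + t) * (1 + t)) * ((1 + u) * B) + (m * t * (B * S) + (2 * m * (B * S) + m * (Y * S)))
                             ≡ B * (m * t * S + 2 * (1 + t) * (2 + t) * (1 + u)) + (2 * m * (B * S) + m * (Y * S))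
  collectG = solve-∀
  collectF : ∀ t u B m S Y Z → (1 + u) * B * S + 2 * t * ((1 + u) * B) + (2 * m * (B * S) + m * (Y * S)) + m * t * (Z + B)
                               ≡ B * ((1 + u) * (S + 2 * t)) + (2 * m * (B * S) + m * (Y * S)) + m * t * (Z + B)
  collectF = solve-∀
  expandF : ∀ m A B Y S t Z → m * ((A + B + (B + Y)) * S + t * (Z + A + (A + B)))
                              ≡ m * A * S + 2 * t * (m * A) + (2 * m * (B * S) + m * (Y * S)) + m * t * (Z + B)
  expandF = solve-∀

layer-gap : ∀ T m′ w → let t = suc T; m = suc m′; u = t * (m + 1) + w in
            m * t * (2 + u) ^ 2 + 2 * (1 + t) * (2 + t) * (1 + u) < (1 + u) * ((2 + u) ^ 2 + 2 * t)
layer-gap T m′ w = ≤-trans (m<m+n _ (s≤s z≤n)) (≤-reflexive (sym (surplus T m′ w)))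
  where
  surplus : ∀ T m′ w → let t = suc T; m = suc m′; u = t * (m + 1) + w; S = (2 + u) * ((2 + u) * 1) in
            (1 + u) * (S + 2 * t)
            ≡ m * t * S + 2 * (1 + t) * (2 + t) * (1 + u) + suc (T + 1 + w * S + (1 + u) * (T + (1 + t) * (t * m′ + w)))
  surplus = solve-∀

-- The extremal case k = t + 1, n = 2t + 2

does≡⇒⇔ : ∀ {A B : Set} (A? : Dec A) (B? : Dec B) → does A? ≡ does B? → A ⇔ B
does≡⇒⇔ (yes a) (yes b) _  = mk⇔ (λ _ → b) (λ _ → a)
does≡⇒⇔ (no ¬a) (no ¬b) _  = mk⇔ (⊥-elim ∘ ¬a) (⊥-elim ∘ ¬b)
does≡⇒⇔ (yes _) (no _)  ()
does≡⇒⇔ (no _)  (yes _) ()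

∈-allSubsets : ∀ n (S : Subset n) → S ∈ allSubsets n
∈-allSubsets zero    []            = here refl
∈-allSubsets (suc n) (outside ∷ S) = ∈-++⁺ˡ (∈-map⁺ (outside ∷_) (∈-allSubsets n S))
∈-allSubsets (suc n) (inside ∷ S)  = ∈-++⁺ʳ (map (outside ∷_) (allSubsets n)) (∈-map⁺ (inside ∷_) (∈-allSubsets n S))

∈-kSubsets-filter : ∀ {n k} {X : Subset n → Set} (X? : Decidable X) (S : Subset n) →
                    S ∈ filter X? (kSubsets n k) ⇔ (∣ S ∣ ≡ k × X S)
∈-kSubsets-filter {n} {k} X? S = mk⇔
  (λ S∈ → let S∈k , XS = ∈-filter⁻ X? {xs = kSubsets n k} S∈
          in proj₂ (∈-filter⁻ (λ s → ∣ s ∣ ≟ k) {xs = allSubsets n} S∈k) , XS)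
  (λ (∣S∣≡k , XS) → ∈-filter⁺ X? (∈-filter⁺ (λ s → ∣ s ∣ ≟ k) (∈-allSubsets n S) ∣S∣≡k) XS)

∁-involutive : ∀ {n} (p : Subset n) → ∁ (∁ p) ≡ p
∁-involutive p = trans (sym (Vecₚ.map-∘ not not p)) (trans (Vecₚ.map-cong not-involutive p) (Vecₚ.map-id p))

∈-compFam : ∀ {n} (𝓖 : Family n) (S : Subset n) → S ∈ compFam 𝓖 ⇔ ∁ S ∈ 𝓖
∈-compFam 𝓖 S = mk⇔
  (λ S∈ → let G , G∈ , S≡∁G = ∈-map⁻ ∁ S∈ in subst (_∈ 𝓖) (sym (trans (cong ∁ S≡∁G) (∁-involutive G))) G∈)
  (λ ∁S∈ → subst (_∈ compFam 𝓖) (∁-involutive S) (∈-map⁺ ∁ ∁S∈))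

∣∁p∣+∣p∣≡n : ∀ {n} (p : Subset n) → ∣ ∁ p ∣ + ∣ p ∣ ≡ n
∣∁p∣+∣p∣≡n {n} p = trans (cong (_+ ∣ p ∣) (∣∁p∣≡n∸∣p∣ p)) (m∸n+n≡m (∣p∣≤n p))

complement-sizes : ∀ {t X Y Z X′ Y′ Z′} → X′ + X ≡ t → Y′ + Y ≡ 2 → Z′ + Z ≡ t →
                   (X + (Y + Z) ≡ t + 1 × X ≡ t) ⇔ (Z′ + (Y′ + X′) ≡ t + 1 × suc t ≤ Z′ + Y′)
complement-sizes {t} {X} {Y} {Z} {X′} {Y′} {Z′} X′+X≡t Y′+Y≡2 Z′+Z≡t = mk⇔ to from
  where
  outside-sum : (Z′ + Y′) + (Z + Y) ≡ (t + 1) + 1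
  outside-sum = trans (+-interchange Z′ Y′ Z Y) (trans (cong₂ _+_ Z′+Z≡t Y′+Y≡2) (sym (+-assoc t 1 1)))
  to : X + (Y + Z) ≡ t + 1 × X ≡ t → Z′ + (Y′ + X′) ≡ t + 1 × suc t ≤ Z′ + Y′
  to (size≡ , X≡t) = trans (cong (λ x → Z′ + (Y′ + x)) X′≡0) (trans (cong (Z′ +_) (+-identityʳ Y′)) Z′+Y′≡)
                   , ≤-reflexive (sym (trans Z′+Y′≡ (+-comm t 1)))
    where
    X′≡0 : X′ ≡ 0
    X′≡0 = +-cancelʳ-≡ X X′ 0 (trans X′+X≡t (sym X≡t))
    Y+Z≡1 : Y + Z ≡ 1
    Y+Z≡1 = +-cancelˡ-≡ t (Y + Z) 1 (trans (cong (_+ (Y + Z)) (sym X≡t)) size≡)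
    Z′+Y′≡ : Z′ + Y′ ≡ t + 1
    Z′+Y′≡ = +-cancelʳ-≡ 1 _ _ (trans (cong ((Z′ + Y′) +_) (sym (trans (+-comm Z Y) Y+Z≡1))) outside-sum)
  from : Z′ + (Y′ + X′) ≡ t + 1 × suc t ≤ Z′ + Y′ → X + (Y + Z) ≡ t + 1 × X ≡ t
  from (size≡ , t<Z′+Y′) = trans (cong (X +_) (+-comm Y Z)) (cong₂ _+_ X≡t Z+Y≡1) , X≡t
    where
    size≡′ : (Z′ + Y′) + X′ ≡ t + 1
    size≡′ = trans (+-assoc Z′ Y′ X′) size≡
    Z′+Y′≡ : Z′ + Y′ ≡ t + 1
    Z′+Y′≡ = ≤-antisym (subst (Z′ + Y′ ≤_) size≡′ (m≤m+n _ _)) (subst (_≤ Z′ + Y′) (+-comm 1 t) t<Z′+Y′)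
    X′≡0 : X′ ≡ 0
    X′≡0 = +-cancelˡ-≡ (Z′ + Y′) X′ 0 (trans size≡′ (sym (trans (+-identityʳ _) Z′+Y′≡)))
    X≡t : X ≡ t
    X≡t = trans (sym (cong (_+ X) X′≡0)) X′+X≡t
    Z+Y≡1 : Z + Y ≡ 1
    Z+Y≡1 = +-cancelˡ-≡ (t + 1) (Z + Y) 1 (trans (cong (_+ (Z + Y)) (sym Z′+Y′≡)) outside-sum)

-- σ exchanges the first t and the last t points of [t + 2 + t] and fixes the two in between.
module BlockSwap (t : ℕ) where

  n = t + (2 + t)

  data Position : Fin n → Set where
    left  : ∀ i → Position (i ↑ˡ (2 + t))
    mid   : ∀ i → Position (t ↑ʳ (i ↑ˡ t))
    right : ∀ i → Position (t ↑ʳ (2 ↑ʳ i))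

  position : ∀ i → Position i
  position i with splitAt t i in eq
  ... | inj₁ a = subst Position (splitAt⁻¹-↑ˡ eq) (left a)
  ... | inj₂ b with splitAt 2 b in eq′
  ...   | inj₁ c = subst Position (trans (cong (t ↑ʳ_) (splitAt⁻¹-↑ˡ eq′)) (splitAt⁻¹-↑ʳ eq)) (mid c)
  ...   | inj₂ d = subst Position (trans (cong (t ↑ʳ_) (splitAt⁻¹-↑ʳ eq′)) (splitAt⁻¹-↑ʳ eq)) (right d)

  swapRest : Fin 2 ⊎ Fin t → Fin n
  swapRest (inj₁ c) = t ↑ʳ (c ↑ˡ t)
  swapRest (inj₂ d) = d ↑ˡ (2 + t)

  swapBlocks : Fin t ⊎ Fin (2 + t) → Fin n
  swapBlocks (inj₁ a) = t ↑ʳ (2 ↑ʳ a)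
  swapBlocks (inj₂ b) = swapRest (splitAt 2 b)

  swap : Fin n → Fin n
  swap = swapBlocks ∘ splitAt t

  swap-left : ∀ i → swap (i ↑ˡ (2 + t)) ≡ t ↑ʳ (2 ↑ʳ i)
  swap-left i rewrite splitAt-↑ˡ t i (2 + t) = refl

  swap-mid : ∀ i → swap (t ↑ʳ (i ↑ˡ t)) ≡ t ↑ʳ (i ↑ˡ t)
  swap-mid i rewrite splitAt-↑ʳ t (2 + t) (i ↑ˡ t) | splitAt-↑ˡ 2 i t = refl

  swap-right : ∀ i → swap (t ↑ʳ (2 ↑ʳ i)) ≡ i ↑ˡ (2 + t)
  swap-right i rewrite splitAt-↑ʳ t (2 + t) (2 ↑ʳ i) | splitAt-↑ʳ 2 t i = refl

  swap-involutive : ∀ i → swap (swap i) ≡ i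
  swap-involutive i = go (position i)
    where
    go : ∀ {i} → Position i → swap (swap i) ≡ i
    go (left i)  = trans (cong swap (swap-left i)) (swap-right i)
    go (mid i)   = trans (cong swap (swap-mid i)) (swap-mid i)
    go (right i) = trans (cong swap (swap-right i)) (swap-left i)

  σ : Permutation′ n
  σ = permutation swap swap swap-involutive swap-involutive

  permSub-σ : ∀ (x : Subset t) (y : Subset 2) (z : Subset t) → permSub σ (x ++ (y ++ z)) ≡ z ++ (y ++ x)
  permSub-σ x y z = trans (tabulate-cong (λ i → go (position i))) (tabulate∘lookup (z ++ (y ++ x)))
    where
    go : ∀ {i} → Position i → lookup (x ++ (y ++ z)) (swap i) ≡ lookup (z ++ (y ++ x)) i
    go (left i) rewrite swap-left i | lookup-++ʳ x (y ++ z) (2 ↑ʳ i) | lookup-++ʳ y z i | lookup-++ˡ z (y ++ x) i = refl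
    go (mid i) rewrite swap-mid i | lookup-++ʳ x (y ++ z) (i ↑ˡ t) | lookup-++ˡ y z i
                     | lookup-++ʳ z (y ++ x) (i ↑ˡ t) | lookup-++ˡ y x i = refl
    go (right i) rewrite swap-right i | lookup-++ˡ x (y ++ z) i | lookup-++ʳ z (y ++ x) (2 ↑ʳ i) | lookup-++ʳ y x i = refl

module _ (t : ℕ) where
  open BlockSwap t

  famF≅compFam-famG : famF t n (t + 1) ≅ compFam (famG t n (t + 1))
  famF≅compFam-famG = σ , λ S → by-blocks S
    where
    k = t + 1
    ∣++∣₃ : ∀ {a b c} (x : Subset a) (y : Subset b) (z : Subset c) → ∣ x ++ (y ++ z) ∣ ≡ ∣ x ∣ + (∣ y ∣ + ∣ z ∣)
    ∣++∣₃ x y z = trans (∣++∣ x (y ++ z)) (cong (∣ x ∣ +_) (∣++∣ y z))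
    ≡k-cong : ∀ {a b} → a ≡ b → (a ≡ k) ⇔ (b ≡ k)
    ≡k-cong a≡b = mk⇔ (trans (sym a≡b)) (trans a≡b)
    blocks : ∀ (x : Subset t) (y : Subset 2) (z : Subset t) →
             (x ++ (y ++ z)) ∈ famF t n k ⇔ permSub σ (x ++ (y ++ z)) ∈ compFam (famG t n k)
    blocks x y z = begin
      (x ++ (y ++ z)) ∈ famF t n k
        ≈⟨ ∈-kSubsets-filter (initSeg n t ⊆?_) (x ++ (y ++ z)) ⟩
      (∣ x ++ (y ++ z) ∣ ≡ k × initSeg n t ⊆ x ++ (y ++ z))
        ≈⟨ ≡k-cong (∣++∣₃ x y z)
           ×-⇔ does≡⇒⇔ (initSeg n t ⊆? (x ++ (y ++ z))) (∣ x ∣ ≟ t) (initSeg-⊆?-++ x (y ++ z)) ⟩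
      (∣ x ∣ + (∣ y ∣ + ∣ z ∣) ≡ k × ∣ x ∣ ≡ t)
        ≈⟨ complement-sizes {t} {∣ x ∣} {∣ y ∣} {∣ z ∣} {∣ ∁ x ∣} {∣ ∁ y ∣} {∣ ∁ z ∣}
                            (∣∁p∣+∣p∣≡n x) (∣∁p∣+∣p∣≡n y) (∣∁p∣+∣p∣≡n z) ⟩
      (∣ ∁ z ∣ + (∣ ∁ y ∣ + ∣ ∁ x ∣) ≡ k × suc t ≤ ∣ ∁ z ∣ + ∣ ∁ y ∣)
        ≈⟨ ≡k-cong (sym ∣∁T∣≡)
           ×-⇔ mk⇔ (subst (suc t ≤_) (sym ∣∁T∩initSeg∣≡)) (subst (suc t ≤_) ∣∁T∩initSeg∣≡) ⟩
      (∣ ∁ (z ++ (y ++ x)) ∣ ≡ k × suc t ≤ ∣ ∁ (z ++ (y ++ x)) ∩ initSeg n (t + 2) ∣)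
        ≈⟨ ∈-kSubsets-filter (λ G → suc t ≤? ∣ G ∩ initSeg n (t + 2) ∣) (∁ (z ++ (y ++ x))) ⟨
      ∁ (z ++ (y ++ x)) ∈ famG t n k
        ≈⟨ ∈-compFam (famG t n k) (z ++ (y ++ x)) ⟨
      (z ++ (y ++ x)) ∈ compFam (famG t n k)
        ≡⟨ cong (_∈ compFam (famG t n k)) (permSub-σ x y z) ⟨
      permSub σ (x ++ (y ++ z)) ∈ compFam (famG t n k)
        ∎
      where
      open SetoidReasoning (⇔-setoid 0ℓ)
      ∁T≡ : ∁ (z ++ (y ++ x)) ≡ ∁ z ++ (∁ y ++ ∁ x)
      ∁T≡ = trans (Vecₚ.map-++ not z (y ++ x)) (cong (∁ z ++_) (Vecₚ.map-++ not y x))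
      ∣∁T∣≡ : ∣ ∁ (z ++ (y ++ x)) ∣ ≡ ∣ ∁ z ∣ + (∣ ∁ y ∣ + ∣ ∁ x ∣)
      ∣∁T∣≡ = trans (cong ∣_∣ ∁T≡) (∣++∣₃ (∁ z) (∁ y) (∁ x))
      ∣∁T∩initSeg∣≡ : ∣ ∁ (z ++ (y ++ x)) ∩ initSeg n (t + 2) ∣ ≡ ∣ ∁ z ∣ + ∣ ∁ y ∣
      ∣∁T∩initSeg∣≡ = trans (cong (λ S → ∣ S ∩ initSeg n (t + 2) ∣) ∁T≡)
        (trans (∣++∩initSeg∣ 2 (∁ z) (∁ y ++ ∁ x)) (cong (∣ ∁ z ∣ +_) (∣++∩initSeg-left∣ (∁ y) (∁ x))))
    by-blocks : ∀ S → S ∈ famF t n k ⇔ permSub σ S ∈ compFam (famG t n k)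
    by-blocks S with Vec.splitAt t S
    ... | x , yz , refl with Vec.splitAt 2 yz
    ... | y , z , refl = blocks x y z

Co₂Comparison : ℕ → ℕ → ℕ → Set
Co₂Comparison t k n = (co₂ n k (famG t n k) ≤ co₂ n k (famF t n k))
                    × (co₂ n k (famG t n k) ≡ co₂ n k (famF t n k) →
                         (k ≡ t + 1) × (n ≡ 2 * t + 2) × (famF t n k ≅ compFam (famG t n k)))

co₂-comparison-k≡t : ∀ T q → Co₂Comparison (suc T) (suc T) (suc T + q)
co₂-comparison-k≡t T q =
  subst (_≤ co₂ (t + q) t (famF t (t + q) t)) (sym 𝓖≡0) z≤n ,
  λ 𝓖≡𝓕 → ⊥-elim (0≢1+n (trans (sym 𝓖≡0) (trans 𝓖≡𝓕 𝓕≡t)))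
  where
  t = suc T
  𝓖≡0 : co₂ (t + q) t (famG t (t + q) t) ≡ 0
  𝓖≡0 = trans (cong (co₂ (t + q) t) (famG-empty t (t + q))) (∑-zero (kSubsets (t + q) T))
  𝓕≡t : co₂ (t + q) t (famF t (t + q) t) ≡ t
  𝓕≡t = trans (co₂-famF T q T)
          (trans (cong₂ (λ x y → x + t * y) (lineSum-beyond q t T (λ l → (q ∸ l) ^ 2) ≤-refl)
                        (trans (cong (lineCount q T) (sym (+-identityʳ T))) (lineCount-exact q T 0)))
                 (*-identityʳ t))

co₂-excess-at-k≡t+1 : ∀ T w → let t = suc T; n = t + (2 + (t + w)) in
                      co₂ n (t + 1) (famF t n (t + 1)) ≡ co₂ n (t + 1) (famG t n (t + 1)) + w * (3 * t + 4 + w)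
co₂-excess-at-k≡t+1 T w =
  trans co₂𝓕 (trans (co₂-excess-k≡t+1 t w ((t + 2) C t) A B Y Z A≡1 B≡0 Z≡t+w (2*[t+2]Ct t))
                    (cong (_+ w * (3 * t + 4 + w)) (sym co₂𝓖)))
  where
  open Layers T 0 (suc T + w)
  A≡1 : A ≡ 1
  A≡1 = trans (cong (lineCount (t + w) t) (trans (+-comm T 1) (sym (+-identityʳ t)))) (lineCount-exact (t + w) t 0)
  B≡0 : B ≡ 0
  B≡0 = lineSum-beyond (t + w) (suc t) (T + 1) (λ _ → 1) (s≤s (≤-reflexive (+-comm T 1)))
  Z≡t+w : Z ≡ t + w
  Z≡t+w = trans (lineCount-exact (t + w) T 1) (nC1≡n (t + w))

co₂-comparison-k≡t+1 : ∀ T w → let t = suc T in Co₂Comparison t (t + 1) (t + (2 + (t + w)))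
co₂-comparison-k≡t+1 T zero =
  subst (co₂ n (t + 1) (famG t n (t + 1)) ≤_) (sym (co₂-excess-at-k≡t+1 T 0)) (m≤m+n _ 0) ,
  λ _ → refl , n≡2t+2 t , subst (λ n → famF t n (t + 1) ≅ compFam (famG t n (t + 1)))
                                (cong (λ x → t + (2 + x)) (sym (+-identityʳ t))) (famF≅compFam-famG t)
  where
  t = suc T
  n = t + (2 + (t + 0))
  n≡2t+2 : ∀ t → t + (2 + (t + 0)) ≡ 2 * t + 2
  n≡2t+2 = solve-∀
co₂-comparison-k≡t+1 T (suc w) = <⇒≤ 𝓖<𝓕 , λ 𝓖≡𝓕 → ⊥-elim (<-irrefl 𝓖≡𝓕 𝓖<𝓕)
  where
  t = suc T
  n = t + (2 + (t + suc w))
  𝓖<𝓕 : co₂ n (t + 1) (famG t n (t + 1)) < co₂ n (t + 1) (famF t n (t + 1))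
  𝓖<𝓕 = subst (co₂ n (t + 1) (famG t n (t + 1)) <_) (sym (co₂-excess-at-k≡t+1 T (suc w)))
               (m<m+n _ (≤-trans (≤-trans (s≤s z≤n) (m≤n+m (suc w) (3 * t + 4))) (m≤m+n _ (w * (3 * t + 4 + suc w)))))

co₂-comparison-k>t+1 : ∀ T m′ w → let t = suc T; m = suc m′ in
                       Co₂Comparison t (t + suc m) (t + (2 + (m + (t * (m + 1) + w))))
co₂-comparison-k>t+1 T m′ w = <⇒≤ 𝓖<𝓕 , λ 𝓖≡𝓕 → ⊥-elim (<-irrefl 𝓖≡𝓕 𝓖<𝓕)
  where
  u = suc T * (suc m′ + 1) + w
  open Layers T (suc m′) u
  n = t + (2 + p)
  A≡ : A ≡ p C suc m′
  A≡ = trans (cong (lineCount p t) (+-suc T (suc m′))) (lineCount-exact p t (suc m′))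
  B≡ : B ≡ p C m′
  B≡ = trans (cong (lineCount p (suc t)) (trans (+-suc T (suc m′)) (cong suc (+-suc T m′)))) (lineCount-exact p (suc t) m′)
  mA≡ : suc m′ * A ≡ (1 + u) * B
  mA≡ = begin
    suc m′ * A
      ≡⟨ cong (suc m′ *_) A≡ ⟩
    suc m′ * (p C suc m′)
      ≡⟨ +-cancelˡ-≡ (m′ * (p C m′)) _ _ (trans (s*nCs+[s+1]*nC[s+1]≡n*nCs p m′) (split m′ u (p C m′))) ⟩
    (1 + u) * (p C m′)
      ≡⟨ cong ((1 + u) *_) B≡ ⟨
    (1 + u) * B
      ∎
    where
    open ≡-Reasoning
    split : ∀ m′ u b → (suc m′ + u) * b ≡ m′ * b + (1 + u) * b
    split = solve-∀
  0<B : 0 < B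
  0<B = subst (0 <_) (sym B≡) (0<nCk (≤-trans (n≤1+n m′) (m≤m+n (suc m′) u)))
  𝓖<𝓕 : co₂ n (suc M) (famG t n (suc M)) < co₂ n (suc M) (famF t n (suc M))
  𝓖<𝓕 = subst₂ _<_ (sym co₂𝓖) (sym co₂𝓕)
    (co₂-gap t (suc m′) u (N ^ 2) ((t + 2) C t) A B Y Z (2*[t+2]Ct t) mA≡ 0<B (layer-gap T m′ w))

co₂-comparison : ∀ T d w → let t = suc T in Co₂Comparison t (t + d) (suc t * suc d + w)
co₂-comparison T zero w =
  subst₂ (Co₂Comparison (suc T)) (sym (+-identityʳ (suc T))) (shape T w) (co₂-comparison-k≡t T (suc w))
  where
  shape : ∀ T w → suc T + suc w ≡ suc (suc T) * 1 + w
  shape = solve-∀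
co₂-comparison T (suc zero) w =
  subst (Co₂Comparison (suc T) (suc T + 1)) (shape T w) (co₂-comparison-k≡t+1 T w)
  where
  shape : ∀ T w → suc T + (2 + (suc T + w)) ≡ suc (suc T) * 2 + w
  shape = solve-∀
co₂-comparison T (suc (suc m′)) w =
  subst (Co₂Comparison (suc T) (suc T + suc (suc m′))) (shape T m′ w) (co₂-comparison-k>t+1 T m′ w)
  where
  shape : ∀ T m′ w → suc T + (2 + (suc m′ + (suc T * (suc m′ + 1) + w))) ≡ suc (suc T) * suc (suc (suc m′)) + w
  shape = solve-∀

lemma10 : (t k n : ℕ) → 1 ≤ t → 1 ≤ k → 1 ≤ n → t ≤ k →
          (suc t) * (suc (k ∸ t)) ≤ n →
          (co₂ n k (famG t n k) ≤ co₂ n k (famF t n k))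
          × (co₂ n k (famG t n k) ≡ co₂ n k (famF t n k) →
               (k ≡ t + 1) × (n ≡ 2 * t + 2) × (famF t n k ≅ compFam (famG t n k)))
lemma10 zero    k n () _ _ _ _
lemma10 (suc T) k n _  _ _ t≤k bound =
  subst₂ (Co₂Comparison (suc T)) (m+[n∸m]≡n t≤k) (m+[n∸m]≡n bound) (co₂-comparison T (k ∸ suc T) _)
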